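{- Let $\alpha=[0;a_1,a_2,\ldots]$ be irrational with $\limsup_{i\to\infty}\lambda_i(\alpha)=\lambda_0$, where $\lambda_0=[3;3,3,2,1,\overline{1,2}]+[0;2,1,\overline{1,2}]$. Then there exists $N\in\mathbb{N}$ such that for every integer $n>N$ with $\lambda_n(\alpha)>3.691$, the term $a_n$ is the left or the right $3$ of an occurrence of the pattern $(1,2,3,3,3,2,1)$ in $(a_1,a_2,\ldots)$; that is, either $(a_{n-4},\ldots,a_{n+2})=(1,2,3,3,3,2,1)$ or $(a_{n-2},\ldots,a_{n+4})=(1,2,3,3,3,2,1)$.
   Context: For an irrational $\alpha=[a_0;a_1,a_2,\ldots]$ and a positive integer $i$, $\lambda_i(\alpha)=[a_i;a_{i+1},a_{i+2},\ldots]+[0;a_{i-1},a_{i-2},\ldots,a_1]$. -}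

module Defs where

open import Data.Nat as ℕ using (ℕ; zero; suc; _∸_; _≥_)
open import Data.Integer using (+_)
open import Data.Product using (_×_; _,_; Σ; ∃)
open import Data.List using (List; []; _∷_; map; upTo)
open import Data.Rational.Unnormalised using (ℚᵘ; mkℚᵘ; _+_; _-_; _≤_; _<_; 0ℚᵘ)
open import Data.Bool using (if_then_else_)
open import Data.Nat using (_%_; _≡ᵇ_)
open import Relation.Binary.PropositionalEquality using (_≡_)

-- Finite continued fractions [b; c₁, …, c_k], evaluated as (numerator, denominator)
-- via the standard recursion  [b; c, …] = b + 1/[c; …].

cfPair : ℕ → List ℕ → ℕ × ℕ
cfPair b [] = b , 1
cfPair b (c ∷ cs) with cfPair c cs
... | p , q = b ℕ.* p ℕ.+ q , p

-- value as a rational (denominator is ≥ 1 whenever all partial quotients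
-- after the first are ≥ 1, which is always the case in our uses)
cfVal : ℕ → List ℕ → ℚᵘ
cfVal b cs with cfPair b cs
... | p , q = mkℚᵘ (+ p) (q ∸ 1)

-- Real numbers given as limits of convergent sequences of rationals.
-- For convergent sequences s, t:  lim s < lim t  iff  ∃ δ>0, eventually s m + δ ≤ t m.

RSeq : Set
RSeq = ℕ → ℚᵘ

const : ℚᵘ → RSeq
const q _ = q

_<ᴿ_ : RSeq → RSeq → Set
s <ᴿ t = Σ ℚᵘ λ δ → (0ℚᵘ < δ) × Σ ℕ λ K → ∀ m → m ≥ K → s m + δ ≤ t m

cfSeq : (ℕ → ℕ) → RSeq
cfSeq c m = cfVal (c 0) (map (λ j → c (suc j)) (upTo m))

-- λ_i(α) for α = [a 0; a 1, a 2, …] and i ≥ 1: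
--   [a_i; a_{i+1}, …] + [0; a_{i-1}, …, a_1]
lam : (ℕ → ℕ) → ℕ → RSeq
lam a i m = cfSeq (λ j → a (i ℕ.+ j)) m
          + cfVal 0 (map (λ j → a (i ∸ suc j)) (upTo (i ∸ 1)))

alt12 : ℕ → ℕ
alt12 k = if (k % 2) ≡ᵇ 0 then 1 else 2

seq1 : ℕ → ℕ
seq1 0 = 3
seq1 1 = 3
seq1 2 = 3
seq1 3 = 2
seq1 4 = 1
seq1 (suc (suc (suc (suc (suc k))))) = alt12 k

seq2 : ℕ → ℕ
seq2 0 = 0
seq2 1 = 2
seq2 2 = 1
seq2 (suc (suc (suc k))) = alt12 k

lambda0 : RSeq
lambda0 m = cfSeq seq1 m + cfSeq seq2 m

-- limsup_{i→∞} λ_i(α) = λ₀, in ε-form: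
-- for every rational ε > 0, eventually λ_i < λ₀ + ε, and
-- infinitely often λ_i > λ₀ - ε.

LimsupLamEq : (ℕ → ℕ) → RSeq → Set
LimsupLamEq a L =
  ∀ (ε : ℚᵘ) → 0ℚᵘ < ε →
    (Σ ℕ λ N → ∀ i → N ℕ.< i → lam a i <ᴿ (λ m → L m + ε))
  × (∀ N → Σ ℕ λ i → N ℕ.< i × ((λ m → L m - ε) <ᴿ lam a i))

Pattern : (ℕ → ℕ) → ℕ → Set
Pattern a j = a j ≡ 1 × a (j ℕ.+ 1) ≡ 2 × a (j ℕ.+ 2) ≡ 3 × a (j ℕ.+ 3) ≡ 3
            × a (j ℕ.+ 4) ≡ 3 × a (j ℕ.+ 5) ≡ 2 × a (j ℕ.+ 6) ≡ 1

-- 3.691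
q3691 : ℚᵘ
q3691 = mkℚᵘ (+ 3691) 999

-- Every continued fraction beginning with a given word lies in an explicit interval, its cylinder,
-- so a finite window of letters around a position bounds λ there from both sides.  These bounds turn
-- λᵢ < λ₀ + ε into aᵢ ∈ {1, 2, 3} for large i, and a search through all windows over {1, 2, 3} of
-- at most 13 letters around n, run by the type checker, finds that each of them forces λₙ ≤ 3.691,
-- or forces λᵢ ≥ λ₀ + ε at some position i of the window, or contains (1,2,3,3,3,2,1) with aₙ as
-- its left or right 3.

module Submission where

open import Defs
open import Data.Nat using (ℕ; suc; _≤_; _<_; _+_)
open import Data.Product using (_×_; Σ)
open import Data.Sum using (_⊎_)
open import Relation.Binary.PropositionalEquality using (_≡_)

open import Data.Bool using (Bool; true; false; T; _∧_; _∨_; if_then_else_)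
open import Data.Bool.Properties using (T-∧; T-∨)
open import Data.Empty using (⊥; ⊥-elim)
open import Data.Integer using (+_; +≤+; +<+)
import Data.Integer as ℤ
import Data.Integer.Properties as ℤ
open import Data.List using (List; []; _∷_; _++_; [_]; _∷ʳ_; _ʳ++_; length; map; upTo; applyUpTo)
open import Data.List.Properties using (map-upTo; length-++; length-applyUpTo)
open import Data.List.Relation.Unary.All using (All; []; _∷_)
open import Data.List.Relation.Unary.All.Properties using (applyUpTo⁺₁; ++⁻ˡ)
open import Data.Nat using (zero; _*_; _∸_; z≤n; s≤s; _≡ᵇ_; _<ᵇ_; _%_)
open import Data.Nat.Properties
open import Data.Nat.Solver using (module +-*-Solver)
open import Data.Product using (_,_; proj₁; proj₂)
open import Data.Rational.Unnormalised using (ℚᵘ; mkℚᵘ; *≤*; *<*; 0ℚᵘ)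
import Data.Rational.Unnormalised as ℚ
import Data.Rational.Unnormalised.Properties as ℚ
open import Data.Sum using (inj₁; inj₂; [_,_]′)
open import Data.Unit using (⊤; tt)
open import Function using (_∘_)
open import Function.Bundles using (module Equivalence)
open import Relation.Binary.PropositionalEquality using (refl; sym; trans; cong; cong₂; subst; subst₂)
open import Relation.Nullary using (¬_)

open Equivalence using (to)

-- Cylinders of continued fractions

Frac : Set
Frac = ℕ × ℕ

num den : Frac → ℕ
num = proj₁
den = proj₂

-- cfPair b (c ∷ cs) reduces to push b (cfPair c cs).
push : ℕ → Frac → Frac
push b (p , q) = b * p + q , p

_≼_ : Frac → Frac → Set
(p , q) ≼ (p′ , q′) = p * q′ ≤ p′ * q

push-antitone : ∀ b {x y} → x ≼ y → push b y ≼ push b x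
push-antitone b {p , q} {c , c′} x≼y = begin
  (b * c + c′) * p    ≡⟨ solve 4 (λ b c c′ p → (b :* c :+ c′) :* p := b :* c :* p :+ p :* c′) refl b c c′ p ⟩
  b * c * p + p * c′  ≤⟨ +-monoʳ-≤ (b * c * p) x≼y ⟩
  b * c * p + c * q   ≡⟨ solve 4 (λ b c p q → b :* c :* p :+ c :* q := (b :* p :+ q) :* c) refl b c p q ⟩
  (b * p + q) * c     ∎
  where open ≤-Reasoning; open +-*-Solver

push-num-positive : ∀ {b} x → 1 ≤ b → 1 ≤ num x → 1 ≤ num (push b x)
push-num-positive {b} (p , q) 1≤b 1≤p = ≤-trans (*-mono-≤ 1≤b 1≤p) (m≤m+n (b * p) q)

Interval : Set
Interval = Frac × Frac

lower upper : Interval → Frac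
lower = proj₁
upper = proj₂

_∈_ : Frac → Interval → Set
x ∈ (lo , hi) = lo ≼ x × x ≼ hi

push-∈ : ∀ b {x lo hi} → x ∈ (lo , hi) → push b x ∈ (push b hi , push b lo)
push-∈ b (lo≼x , x≼hi) = push-antitone b x≼hi , push-antitone b lo≼x

-- Contains every [x; w, t₁, …, tₖ] with all tᵢ ≥ 1; push reverses order, so the endpoints swap.
cylinder : ℕ → List ℕ → Interval
cylinder x []      = (x , 1) , (suc x , 1)
cylinder x (y ∷ w) = push x (upper (cylinder y w)) , push x (lower (cylinder y w))

≥1-∈-cylinder : ∀ {c y} → 1 ≤ c → y ∈ cylinder c [] → (1 , 1) ≼ y
≥1-∈-cylinder {c} {p , q} 1≤c (c≼y , _) = ≤-trans (*-monoˡ-≤ q 1≤c) c≼y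

push-∈-cylinder : ∀ x {y} → (1 , 1) ≼ y → push x y ∈ cylinder x []
push-∈-cylinder x {p , q} 1≼y = x≼ , ≼suc-x
  where
  open ≤-Reasoning
  x≼ : x * p ≤ (x * p + q) * 1
  x≼ = ≤-trans (m≤m+n (x * p) q) (≤-reflexive (sym (*-identityʳ _)))
  ≼suc-x : (x * p + q) * 1 ≤ suc x * p
  ≼suc-x = begin
    (x * p + q) * 1  ≡⟨ *-identityʳ _ ⟩
    x * p + q        ≤⟨ +-monoʳ-≤ (x * p) (subst₂ _≤_ (*-identityˡ q) (*-identityʳ p) 1≼y) ⟩
    x * p + p        ≡⟨ +-comm (x * p) p ⟩
    suc x * p        ∎

cfPair-∈-cylinder : ∀ x w {cs} → All (1 ≤_) (w ++ cs) → cfPair x (w ++ cs) ∈ cylinder x w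
cfPair-∈-cylinder x [] {[]}     []         = ≤-refl , *-monoˡ-≤ 1 (n≤1+n x)
cfPair-∈-cylinder x [] {c ∷ cs} (1≤c ∷ ps) =
  push-∈-cylinder x (≥1-∈-cylinder {y = cfPair c cs} 1≤c (cfPair-∈-cylinder c [] ps))
cfPair-∈-cylinder x (y ∷ w)     (_ ∷ ps)   = push-∈ x (cfPair-∈-cylinder y w ps)

cfPair-num-positive : ∀ {x} cs → 1 ≤ x → All (1 ≤_) cs → 1 ≤ num (cfPair x cs)
cfPair-num-positive []       1≤x []         = 1≤x
cfPair-num-positive (c ∷ cs) 1≤x (1≤c ∷ ps) = push-num-positive _ 1≤x (cfPair-num-positive cs 1≤c ps)

cfPair-den-positive : ∀ x {cs} → All (1 ≤_) cs → 1 ≤ den (cfPair x cs)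
cfPair-den-positive x []         = ≤-refl
cfPair-den-positive x (1≤c ∷ ps) = cfPair-num-positive _ 1≤c ps

cylinder-num-positive : ∀ {x} w → 1 ≤ x → All (1 ≤_) w →
  1 ≤ num (lower (cylinder x w)) × 1 ≤ num (upper (cylinder x w))
cylinder-num-positive []      1≤x []         = 1≤x , s≤s z≤n
cylinder-num-positive (y ∷ w) 1≤x (1≤y ∷ ps) =
  push-num-positive _ 1≤x (proj₂ ih) , push-num-positive _ 1≤x (proj₁ ih)
  where ih = cylinder-num-positive w 1≤y ps

cylinder-den-positive : ∀ x {w} → All (1 ≤_) w →
  1 ≤ den (lower (cylinder x w)) × 1 ≤ den (upper (cylinder x w))
cylinder-den-positive x []                 = ≤-refl , ≤-refl
cylinder-den-positive x {y ∷ w} (1≤y ∷ ps) =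
  proj₂ (cylinder-num-positive w 1≤y ps) , proj₁ (cylinder-num-positive w 1≤y ps)

toℚᵘ : Frac → ℚᵘ
toℚᵘ (p , q) = mkℚᵘ (+ p) (q ∸ 1)

toℚᵘ-mono : ∀ {x y} → 1 ≤ den x → 1 ≤ den y → x ≼ y → toℚᵘ x ℚ.≤ toℚᵘ y
toℚᵘ-mono {p , suc q} {p′ , suc q′} _ _ x≼y =
  *≤* (subst₂ ℤ._≤_ (ℤ.pos-* p (suc q′)) (ℤ.pos-* p′ (suc q)) (+≤+ x≼y))

_∈ᵘ_ : ℚᵘ → Interval → Set
v ∈ᵘ I = toℚᵘ (lower I) ℚ.≤ v × v ℚ.≤ toℚᵘ (upper I)

cfPair-∈ᵘ-cylinder : ∀ x w {cs} → All (1 ≤_) (w ++ cs) → toℚᵘ (cfPair x (w ++ cs)) ∈ᵘ cylinder x w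
cfPair-∈ᵘ-cylinder x w ps =
  toℚᵘ-mono (proj₁ cyl-den) val-den (proj₁ ∈cyl) , toℚᵘ-mono val-den (proj₂ cyl-den) (proj₂ ∈cyl)
  where
  ∈cyl    = cfPair-∈-cylinder x w ps
  val-den = cfPair-den-positive x ps
  cyl-den = cylinder-den-positive x (++⁻ˡ w ps)

cfVal-map-upTo : ∀ b f n → cfVal b (map f (upTo n)) ≡ toℚᵘ (cfPair b (applyUpTo f n))
cfVal-map-upTo b f n = cong (toℚᵘ ∘ cfPair b) (map-upTo f n)

StartsWith : (ℕ → ℕ) → List ℕ → Set
StartsWith f []      = ⊤
StartsWith f (x ∷ w) = f 0 ≡ x × StartsWith (f ∘ suc) w

StartsWith-cong : ∀ {f g} w → (∀ k → f k ≡ g k) → StartsWith f w → StartsWith g w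
StartsWith-cong []      f≗g _          = tt
StartsWith-cong (x ∷ w) f≗g (fx , fw) = trans (sym (f≗g 0)) fx , StartsWith-cong w (f≗g ∘ suc) fw

StartsWith-∷ʳ : ∀ f w → StartsWith f w → StartsWith f (w ∷ʳ f (length w))
StartsWith-∷ʳ f []      _         = refl , tt
StartsWith-∷ʳ f (x ∷ w) (fx , fw) = fx , StartsWith-∷ʳ (f ∘ suc) w fw

StartsWith-applyUpTo : ∀ f n → StartsWith f (applyUpTo f n)
StartsWith-applyUpTo f zero    = tt
StartsWith-applyUpTo f (suc n) = refl , StartsWith-applyUpTo (f ∘ suc) n

applyUpTo-split : ∀ f w {m} → StartsWith f w → length w ≤ m → Σ (List ℕ) λ cs → applyUpTo f m ≡ w ++ cs
applyUpTo-split f []      {m}     _         _       = applyUpTo f m , refl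
applyUpTo-split f (x ∷ w) {suc m} (fx , fw) (s≤s le) =
  let cs , eq = applyUpTo-split (f ∘ suc) w fw le in cs , cong₂ _∷_ fx eq

convergent-∈ᵘ-cylinder : ∀ x w {f m} → All (1 ≤_) (applyUpTo f m) → StartsWith f w → length w ≤ m →
  toℚᵘ (cfPair x (applyUpTo f m)) ∈ᵘ cylinder x w
convergent-∈ᵘ-cylinder x w {f} ps fw le with applyUpTo-split f w fw le
... | cs , eq rewrite eq = cfPair-∈ᵘ-cylinder x w ps

alt12-positive : ∀ k → 1 ≤ alt12 k
alt12-positive k = if-positive (k % 2 ≡ᵇ 0)
  where
  if-positive : ∀ b → 1 ≤ (if b then 1 else 2)
  if-positive true  = s≤s z≤n
  if-positive false = s≤s z≤n

seq1-positive : ∀ k → 1 ≤ seq1 (suc k)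
seq1-positive 0 = s≤s z≤n
seq1-positive 1 = s≤s z≤n
seq1-positive 2 = s≤s z≤n
seq1-positive 3 = s≤s z≤n
seq1-positive (suc (suc (suc (suc k)))) = alt12-positive k

seq2-positive : ∀ k → 1 ≤ seq2 (suc k)
seq2-positive 0 = s≤s z≤n
seq2-positive 1 = s≤s z≤n
seq2-positive (suc (suc k)) = alt12-positive k

cfSeq-≤-cylinder : ∀ g N {m} → (∀ k → 1 ≤ g (suc k)) → N ≤ m →
  cfSeq g m ℚ.≤ toℚᵘ (upper (cylinder (g 0) (applyUpTo (g ∘ suc) N)))
cfSeq-≤-cylinder g N {m} g-pos N≤m rewrite cfVal-map-upTo (g 0) (g ∘ suc) m =
  proj₂ (convergent-∈ᵘ-cylinder (g 0) (applyUpTo (g ∘ suc) N) (applyUpTo⁺₁ _ m (λ _ → g-pos _))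
           (StartsWith-applyUpTo (g ∘ suc) N) (subst (_≤ m) (sym (length-applyUpTo _ N)) N≤m))

lambda0Upper : ℚᵘ
lambda0Upper = toℚᵘ (upper (cylinder 3 (applyUpTo (seq1 ∘ suc) 19)))
         ℚ.+ toℚᵘ (upper (cylinder 0 (applyUpTo (seq2 ∘ suc) 19)))

lambda0≤lambda0Upper : ∀ m → 19 ≤ m → lambda0 m ℚ.≤ lambda0Upper
lambda0≤lambda0Upper m 19≤m =
  ℚ.+-mono-≤ (cfSeq-≤-cylinder seq1 19 seq1-positive 19≤m) (cfSeq-≤-cylinder seq2 19 seq2-positive 19≤m)

_≤ᴱ_ : RSeq → RSeq → Set
s ≤ᴱ t = Σ ℕ λ K → ∀ m → K ≤ m → s m ℚ.≤ t m

<ᴿ⇒≱ᴱ : ∀ {s t} → s <ᴿ t → ¬ (t ≤ᴱ s)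
<ᴿ⇒≱ᴱ {s} {t} (δ , δ>0 , K′ , s+δ≤t) (K , t≤s) =
  ℚ.<-irrefl (ℚ.+-identityʳ (s m)) (ℚ.<-≤-trans (ℚ.+-monoʳ-< (s m) δ>0)
    (ℚ.≤-trans (s+δ≤t m (m≤n+m K′ K)) (t≤s m (m≤m+n K K′))))
  where m = K + K′

-- Windows of letters around a position

length-∷ʳ : ∀ (xs : List ℕ) {x} → length (xs ∷ʳ x) ≡ suc (length xs)
length-∷ʳ xs = trans (length-++ xs) (+-comm (length xs) 1)

-- behind lists a (n ∸ 1), a (n ∸ 2), …, never reaching a 0; ahead lists a n, a (n + 1), ….
record Located (a : ℕ → ℕ) (n : ℕ) (ls rs : List ℕ) : Set where
  constructor located
  field
    behind : StartsWith (λ k → a (n ∸ suc k)) ls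
    ls<n   : length ls < n
    ahead  : StartsWith (λ k → a (n + k)) rs

module _ {a : ℕ → ℕ} where

  located-singleton : ∀ {n} → 0 < n → Located a n [] [ a n ]
  located-singleton {n} 0<n = located tt 0<n (cong a (+-identityʳ n) , tt)

  moveRight : ∀ {n ls x rs} → Located a n ls (x ∷ rs) → Located a (suc n) (x ∷ ls) rs
  moveRight {n} {rs = rs} (located sl ls<n (ax , sr)) =
    located (trans (cong a (sym (+-identityʳ n))) ax , sl) (s≤s ls<n)
            (StartsWith-cong rs (λ k → cong a (+-suc n k)) sr)

  moveLeft : ∀ {n x ls rs} → Located a (suc n) (x ∷ ls) rs → Located a n ls (x ∷ rs)
  moveLeft {n} {rs = rs} (located (ax , sl) (s≤s ls<n) sr) =
    located sl ls<n (trans (cong a (+-identityʳ n)) ax , StartsWith-cong rs (λ k → cong a (sym (+-suc n k))) sr)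

  rewind : ∀ {n} ls rs → Located a n ls rs → Located a (n ∸ length ls) [] (ls ʳ++ rs)
  rewind         []       rs loc = loc
  rewind {suc n} (x ∷ ls) rs loc = rewind ls (x ∷ rs) (moveLeft loc)
  rewind {zero}  (x ∷ ls) rs (located _ () _)

  extendLeft : ∀ {n ls rs} → suc (length ls) < n →
    Located a n ls rs → Located a n (ls ∷ʳ a (n ∸ suc (length ls))) rs
  extendLeft {n} {ls} lt (located sl _ sr) =
    located (StartsWith-∷ʳ _ ls sl) (subst (_< n) (sym (length-∷ʳ ls)) lt) sr

  extendRight : ∀ {n ls rs} → Located a n ls rs → Located a n ls (rs ∷ʳ a (n + length rs))
  extendRight {rs = rs} (located sl ls<n sr) = located sl ls<n (StartsWith-∷ʳ _ rs sr)

lamLower lamUpper : List ℕ → ℕ → List ℕ → ℚᵘ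
lamLower ls x rs = toℚᵘ (lower (cylinder x rs)) ℚ.+ toℚᵘ (lower (cylinder 0 ls))
lamUpper ls x rs = toℚᵘ (upper (cylinder x rs)) ℚ.+ toℚᵘ (upper (cylinder 0 ls))

module _ {a : ℕ → ℕ} (a-pos : ∀ i → 1 ≤ a (suc i)) where

  a-positive : ∀ {i} → 0 < i → 1 ≤ a i
  a-positive {suc i} _ = a-pos i

  lam-≡ : ∀ n m → lam a n m ≡ toℚᵘ (cfPair (a (n + 0)) (applyUpTo (λ k → a (n + suc k)) m))
                         ℚ.+ toℚᵘ (cfPair 0 (applyUpTo (λ k → a (n ∸ suc k)) (n ∸ 1)))
  lam-≡ n m = cong₂ ℚ._+_ (cfVal-map-upTo _ _ m) (cfVal-map-upTo 0 _ (n ∸ 1))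

  lam-bounds : ∀ {n ls x rs} → Located a n ls (x ∷ rs) → ∀ m → length rs ≤ m →
    lamLower ls x rs ℚ.≤ lam a n m × lam a n m ℚ.≤ lamUpper ls x rs
  lam-bounds {n} {ls} {rs = rs} (located sl ls<n (refl , sr)) m rs≤m rewrite lam-≡ n m =
    ℚ.+-mono-≤ (proj₁ ahead) (proj₁ behind) , ℚ.+-mono-≤ (proj₂ ahead) (proj₂ behind)
    where
    forward-positive : ∀ {k} → k < m → 1 ≤ a (n + suc k)
    forward-positive {k} _ = subst (λ i → 1 ≤ a i) (sym (+-suc n k)) (a-pos (n + k))
    backward-positive : ∀ n {k} → k < n ∸ 1 → 1 ≤ a (n ∸ suc k)
    backward-positive (suc n) k<n = a-positive (m<n⇒0<n∸m k<n)
    ahead  = convergent-∈ᵘ-cylinder _ rs (applyUpTo⁺₁ _ m forward-positive) sr rs≤m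
    behind = convergent-∈ᵘ-cylinder 0 ls (applyUpTo⁺₁ _ (n ∸ 1) (backward-positive n)) sl (<⇒≤pred ls<n)

-- The search

ε : ℚᵘ
ε = mkℚᵘ (+ 1) 99999

pattern1233321 : List ℕ
pattern1233321 = 1 ∷ 2 ∷ 3 ∷ 3 ∷ 3 ∷ 2 ∷ 1 ∷ []

_isPrefixOf_ : List ℕ → List ℕ → Bool
[]       isPrefixOf _        = true
(p ∷ ps) isPrefixOf []       = false
(p ∷ ps) isPrefixOf (x ∷ xs) = (p ≡ᵇ x) ∧ (ps isPrefixOf xs)

patternStartsLeftBy : ℕ → List ℕ → List ℕ → Bool
patternStartsLeftBy zero    ls       rs = pattern1233321 isPrefixOf rs
patternStartsLeftBy (suc k) []       rs = false
patternStartsLeftBy (suc k) (x ∷ ls) rs = patternStartsLeftBy k ls (x ∷ rs)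

belowThreshold : List ℕ → List ℕ → Bool
belowThreshold ls []       = false
belowThreshold ls (x ∷ rs) = lamUpper ls x rs ℚ.≤ᵇ q3691

exceedsLimsup : List ℕ → ℕ → List ℕ → Bool
exceedsLimsup ls x rs = (lambda0Upper ℚ.+ ε) ℚ.≤ᵇ lamLower ls x rs

anyExceedsFrom : List ℕ → List ℕ → Bool
anyExceedsFrom ls []       = false
anyExceedsFrom ls (x ∷ rs) = exceedsLimsup ls x rs ∨ anyExceedsFrom (x ∷ ls) rs

settled : List ℕ → List ℕ → Bool
settled ls rs = belowThreshold ls rs ∨ anyExceedsFrom [] (ls ʳ++ rs)
              ∨ patternStartsLeftBy 4 ls rs ∨ patternStartsLeftBy 2 ls rs

forEachLetter : (ℕ → Bool) → Bool
forEachLetter f = f 1 ∧ f 2 ∧ f 3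

mutual
  search : ℕ → List ℕ → List ℕ → Bool
  search zero    ls rs = settled ls rs
  search (suc f) ls rs = settled ls rs ∨ grow f ls rs (suc (length ls) <ᵇ length rs)

  grow : ℕ → List ℕ → List ℕ → Bool → Bool
  grow f ls rs true  = forEachLetter λ x → search f (ls ∷ʳ x) rs
  grow f ls rs false = forEachLetter λ x → search f ls (rs ∷ʳ x)

search-succeeds : T (forEachLetter λ x → search 12 [] [ x ])
search-succeeds = tt

-- Soundness of the search

forEachLetter-sound : ∀ f {x} → 1 ≤ x × x ≤ 3 → T (forEachLetter f) → T (f x)
forEachLetter-sound f {1} _ t = proj₁ (to (T-∧ {f 1}) t)
forEachLetter-sound f {2} _ t = proj₁ (to (T-∧ {f 2}) (proj₂ (to (T-∧ {f 1}) t)))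
forEachLetter-sound f {3} _ t = proj₂ (to (T-∧ {f 2}) (proj₂ (to (T-∧ {f 1}) t)))
forEachLetter-sound f {suc (suc (suc (suc _)))} (_ , s≤s (s≤s (s≤s ()))) _

isPrefixOf-sound : ∀ {f} ps xs → T (ps isPrefixOf xs) → StartsWith f xs → StartsWith f ps
isPrefixOf-sound []       xs       _ _         = tt
isPrefixOf-sound (p ∷ ps) (x ∷ xs) t (fx , fxs) =
  trans fx (sym (≡ᵇ⇒≡ p x (proj₁ (to (T-∧ {p ≡ᵇ x}) t)))) , isPrefixOf-sound ps xs (proj₂ (to (T-∧ {p ≡ᵇ x}) t)) fxs

pattern-at : ∀ {a} j → StartsWith (λ k → a (j + k)) pattern1233321 → Pattern a j
pattern-at {a} j (e₀ , e₁ , e₂ , e₃ , e₄ , e₅ , e₆ , _) =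
  trans (cong a (sym (+-identityʳ j))) e₀ , e₁ , e₂ , e₃ , e₄ , e₅ , e₆

AtOuterThree : (ℕ → ℕ) → ℕ → Set
AtOuterThree a n = (Σ ℕ λ j → j + 4 ≡ n × Pattern a j) ⊎ (Σ ℕ λ j → j + 2 ≡ n × Pattern a j)

patternStartsLeftBy-sound : ∀ {a} k {n} ls rs → Located a n ls rs → T (patternStartsLeftBy k ls rs) →
  Σ ℕ λ j → j + k ≡ n × Pattern a j
patternStartsLeftBy-sound {a} zero {n} ls rs loc t =
  n , +-identityʳ n , pattern-at {a} n (isPrefixOf-sound pattern1233321 rs t (Located.ahead loc))
patternStartsLeftBy-sound (suc k) {suc n} (x ∷ ls) rs loc t =
  let j , j+k≡n , pat = patternStartsLeftBy-sound k ls (x ∷ rs) (moveLeft loc) t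
  in j , trans (+-suc j k) (cong suc j+k≡n) , pat
patternStartsLeftBy-sound (suc k) {zero} (x ∷ ls) rs (located _ () _) _

module Soundness (a : ℕ → ℕ) (a-pos : ∀ i → 1 ≤ a (suc i)) (N₀ : ℕ)
                 (limsup< : ∀ i → N₀ < i → lam a i <ᴿ (λ m → lambda0 m ℚ.+ ε)) where

  not-exceeds : ∀ {n ls x rs} → N₀ < n → Located a n ls (x ∷ rs) →
    lambda0Upper ℚ.+ ε ℚ.≤ lamLower ls x rs → ⊥
  not-exceeds {n} {ls} {x} {rs} N₀<n loc exceeds = <ᴿ⇒≱ᴱ (limsup< n N₀<n) (19 + length rs , above)
    where
    open ℚ.≤-Reasoning
    above : ∀ m → 19 + length rs ≤ m → lambda0 m ℚ.+ ε ℚ.≤ lam a n m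
    above m le = begin
      lambda0 m ℚ.+ ε     ≤⟨ ℚ.+-monoˡ-≤ ε (lambda0≤lambda0Upper m (≤-trans (m≤m+n 19 _) le)) ⟩
      lambda0Upper ℚ.+ ε  ≤⟨ exceeds ⟩
      lamLower ls x rs    ≤⟨ proj₁ (lam-bounds a-pos loc m (≤-trans (m≤n+m _ 19) le)) ⟩
      lam a n m           ∎

  letter-bounds : ∀ i → N₀ < i → 1 ≤ a i × a i ≤ 3
  letter-bounds i N₀<i = a-positive {a} a-pos 0<i , ≮⇒≥ 3<ai⇒⊥
    where
    0<i = ≤-<-trans z≤n N₀<i
    bound-below-4 : lambda0Upper ℚ.+ ε ℚ.≤ lamLower [] 4 []
    bound-below-4 = ℚ.≤ᵇ⇒≤ tt
    3<ai⇒⊥ : 3 < a i → ⊥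
    3<ai⇒⊥ 4≤ai = not-exceeds N₀<i (located-singleton 0<i) (ℚ.≤-trans bound-below-4
      (ℚ.+-monoˡ-≤ (toℚᵘ (0 , 1)) (toℚᵘ-mono {4 , 1} {a i , 1} (s≤s z≤n) (s≤s z≤n) (*-monoˡ-≤ 1 4≤ai))))

  anyExceedsFrom-sound : ∀ {n} ls rs → N₀ < n → Located a n ls rs → T (anyExceedsFrom ls rs) → ⊥
  anyExceedsFrom-sound ls []       N₀<n loc ()
  anyExceedsFrom-sound ls (x ∷ rs) N₀<n loc t =
    [ not-exceeds N₀<n loc ∘ ℚ.≤ᵇ⇒≤
    , anyExceedsFrom-sound (x ∷ ls) rs (m<n⇒m<1+n N₀<n) (moveRight loc) ]′ (to (T-∨ {exceedsLimsup ls x rs}) t)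

  belowThreshold-sound : ∀ {n} ls rs → Located a n ls rs → const q3691 <ᴿ lam a n →
    T (belowThreshold ls rs) → ⊥
  belowThreshold-sound ls []       loc above ()
  belowThreshold-sound ls (x ∷ rs) loc above t = <ᴿ⇒≱ᴱ above (length rs , below)
    where
    below : ∀ m → length rs ≤ m → lam a _ m ℚ.≤ q3691
    below m rs≤m = ℚ.≤-trans (proj₂ (lam-bounds a-pos loc m rs≤m)) (ℚ.≤ᵇ⇒≤ t)

  settled-sound : ∀ {n} ls rs → N₀ + length ls < n → Located a n ls rs → const q3691 <ᴿ lam a n →
    T (settled ls rs) → AtOuterThree a n
  settled-sound ls rs bound loc above t =
    [ ⊥-elim ∘ belowThreshold-sound ls rs loc above
    , [ ⊥-elim ∘ anyExceedsFrom-sound [] (ls ʳ++ rs) (m+n≤o⇒m≤o∸n (suc N₀) bound) (rewind ls rs loc)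
      , [ inj₁ ∘ patternStartsLeftBy-sound 4 ls rs loc
        , inj₂ ∘ patternStartsLeftBy-sound 2 ls rs loc
        ]′ ∘ to (T-∨ {patternStartsLeftBy 4 ls rs})
      ]′ ∘ to (T-∨ {anyExceedsFrom [] (ls ʳ++ rs)})
    ]′ (to (T-∨ {belowThreshold ls rs}) t)

  mutual
    search-sound : ∀ f {n} ls rs → N₀ + (f + length ls) < n → Located a n ls rs →
      const q3691 <ᴿ lam a n → T (search f ls rs) → AtOuterThree a n
    search-sound zero    ls rs bound loc above t = settled-sound ls rs bound loc above t
    search-sound (suc f) ls rs bound loc above t =
      [ settled-sound ls rs (≤-<-trans (+-monoʳ-≤ N₀ (m≤n+m (length ls) (suc f))) bound) loc above
      , grow-sound f ls rs (suc (length ls) <ᵇ length rs) bound loc above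
      ]′ (to (T-∨ {settled ls rs}) t)

    grow-sound : ∀ f {n} ls rs b → N₀ + (suc f + length ls) < n → Located a n ls rs →
      const q3691 <ᴿ lam a n → T (grow f ls rs b) → AtOuterThree a n
    grow-sound f {n} ls rs true bound loc above t =
      search-sound f (ls ∷ʳ a i) rs bound′ (extendLeft room loc) above
        (forEachLetter-sound (λ x → search f (ls ∷ʳ x) rs) (letter-bounds i N₀<i) t)
      where
      i = n ∸ suc (length ls)
      N₀+ls<n : N₀ + suc (length ls) < n
      N₀+ls<n = ≤-<-trans (+-monoʳ-≤ N₀ (s≤s (m≤n+m (length ls) f))) bound
      room : suc (length ls) < n
      room = ≤-<-trans (m≤n+m _ N₀) N₀+ls<n
      N₀<i : N₀ < i
      N₀<i = m+n≤o⇒m≤o∸n (suc N₀) N₀+ls<n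
      bound′ : N₀ + (f + length (ls ∷ʳ a i)) < n
      bound′ = subst (λ k → N₀ + k < n) (sym (trans (cong (λ k → f + k) (length-∷ʳ ls)) (+-suc f (length ls)))) bound
    grow-sound f {n} ls rs false bound loc above t =
      search-sound f ls (rs ∷ʳ a (n + length rs)) bound′ (extendRight loc) above
        (forEachLetter-sound (λ x → search f ls (rs ∷ʳ x)) (letter-bounds (n + length rs) N₀<n+rs) t)
      where
      bound′ : N₀ + (f + length ls) < n
      bound′ = ≤-<-trans (+-monoʳ-≤ N₀ (+-monoˡ-≤ (length ls) (n≤1+n f))) bound
      N₀<n+rs : N₀ < n + length rs
      N₀<n+rs = <-≤-trans (≤-<-trans (m≤m+n N₀ _) bound) (m≤m+n n (length rs))

ε>0 : 0ℚᵘ ℚ.< ε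
ε>0 = *<* (+<+ (s≤s z≤n))

lemma5 : (a : ℕ → ℕ) → a 0 ≡ 0 → (∀ i → 1 ≤ a (suc i))
       → LimsupLamEq a lambda0
       → Σ ℕ λ N → ∀ n → N < n → const q3691 <ᴿ lam a n
         → (Σ ℕ λ j → j + 4 ≡ n × Pattern a j)
           ⊎ (Σ ℕ λ j → j + 2 ≡ n × Pattern a j)
lemma5 a _ a-pos limsup = N₀ + 12 , at-outer-three
  where
  N₀ = proj₁ (proj₁ (limsup ε ε>0))
  open Soundness a a-pos N₀ (proj₂ (proj₁ (limsup ε ε>0)))
  at-outer-three : ∀ n → N₀ + 12 < n → const q3691 <ᴿ lam a n → AtOuterThree a n
  at-outer-three n bound above =
    search-sound 12 [] [ a n ] bound (located-singleton (≤-<-trans z≤n bound)) above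
      (forEachLetter-sound (λ x → search 12 [] [ x ]) (letter-bounds n (≤-<-trans (m≤m+n N₀ 12) bound))
        search-succeeds)
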